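{- Let $\mathcal{P},\mathcal{Q}$ be normal posets, let $F\subset\mathcal{P}\times\mathcal{Q}$ be a 2-part Sperner system, and let $C_1,C_2$ be maximal chains of $\mathcal{P}$ and $\mathcal{Q}$ respectively. Then $|F\cap(C_1\times C_2)|\le\min\{r(\mathcal{P}),r(\mathcal{Q})\}+1$.
   Context: All posets are finite and ranked: every minimal element has rank $0$, $r(b)=r(a)+1$ whenever $b$ covers $a$, $\mathcal{P}_i$ is the set of rank-$i$ elements, $N_i=|\mathcal{P}_i|$, $r(\mathcal{P})$ the maximum rank. For $B\subset\mathcal{P}_i$, $\Gamma^-(B)$ is the set of rank-$(i-1)$ elements below some element of $B$. $\mathcal{P}$ is normal if it is graded (all maximal elements have rank $r(\mathcal{P})$) and for every $i\ge1$ and $B\subset\mathcal{P}_i$, $|B|/N_i\le|\Gamma^-(B)|/N_{i-1}$. A set $F\subset\mathcal{P}\times\mathcal{Q}$ is a 2-part Sperner system if there are no two distinct $(x,y),(u,v)\in F$ with $x\le u$, $y\le v$ and ($x=u$ or $y=v$). -}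

module Defs where

open import Data.Nat using (ℕ; zero; suc; _+_; _*_; _≤_; _⊔_; _⊓_; pred)
open import Data.Nat.Properties using (_≟_)
open import Data.Bool using (Bool; true; false; _∧_; if_then_else_)
open import Data.Fin using (Fin)
open import Data.List using (List; foldr; map)
open import Data.Bool.ListAction using (any)
open import Data.List using () renaming (allFin to allFinL)
open import Data.Product using (_×_; _,_; ∃-syntax)
open import Data.Sum using (_⊎_)
open import Relation.Binary.PropositionalEquality using (_≡_; _≢_)
open import Relation.Binary.Definitions using (Decidable)
open import Relation.Binary.Structures using (IsPartialOrder)
open import Relation.Nullary using (¬_)
open import Relation.Nullary.Decidable using (⌊_⌋)
open import Level using (0ℓ)

-- A finite poset whose underlying set is Fin n (finite sets up to relabelling),
-- with a decidable order relation.
record FinPoset (n : ℕ) : Set₁ where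
  field
    _≼_        : Fin n → Fin n → Set
    isPartialOrder : IsPartialOrder _≡_ _≼_
    _≼?_       : Decidable _≼_

  _≺_ : Fin n → Fin n → Set
  a ≺ b = a ≼ b × a ≢ b

  Covers : Fin n → Fin n → Set
  Covers b a = a ≺ b × (∀ c → ¬ (a ≺ c × c ≺ b))

  Minimal : Fin n → Set
  Minimal a = ∀ c → ¬ (c ≺ a)

  Maximal : Fin n → Set
  Maximal a = ∀ c → ¬ (a ≺ c)

count : ∀ {n} → (Fin n → Bool) → ℕ
count {n} S = foldr (λ x acc → (if S x then 1 else 0) + acc) 0 (allFinL n)

_⊆_ : ∀ {n} → (Fin n → Bool) → (Fin n → Bool) → Set
S ⊆ T = ∀ x → S x ≡ true → T x ≡ true

record RankedPoset (n : ℕ) : Set₁ where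
  field
    poset : FinPoset n
    rank  : Fin n → ℕ
    rank-minimal : ∀ a → FinPoset.Minimal poset a → rank a ≡ 0
    rank-cover   : ∀ a b → FinPoset.Covers poset b a → rank b ≡ suc (rank a)

  open FinPoset poset public

  -- r(P): the maximum rank (0 for the empty poset)
  r : ℕ
  r = foldr _⊔_ 0 (map rank (allFinL n))

  level : ℕ → Fin n → Bool
  level i x = ⌊ rank x ≟ i ⌋

  N : ℕ → ℕ
  N i = count (level i)

  Γ⁻ : ℕ → (Fin n → Bool) → Fin n → Bool
  Γ⁻ i B y = level (pred i) y ∧ any (λ x → B x ∧ ⌊ y ≼? x ⌋) (allFinL n)

  Graded : Set
  Graded = ∀ a → Maximal a → rank a ≡ r

  -- normal: graded and |B|/N_i ≤ |Γ⁻(B)|/N_{i-1} for all i ≥ 1, B ⊆ P_i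
  -- (stated cross-multiplied: |B| · N_{i-1} ≤ |Γ⁻(B)| · N_i)
  Normal : Set
  Normal = Graded × (∀ i → (B : Fin n → Bool) → B ⊆ level (suc i) →
             count B * N i ≤ count (Γ⁻ (suc i) B) * N (suc i))

  Chain : (Fin n → Bool) → Set
  Chain C = ∀ x y → C x ≡ true → C y ≡ true → (x ≼ y) ⊎ (y ≼ x)

  MaximalChain : (Fin n → Bool) → Set
  MaximalChain C = Chain C × (∀ D → Chain D → C ⊆ D → D ⊆ C)

open RankedPoset public using (r; Normal; MaximalChain)

TwoPartSperner : ∀ {n m} → RankedPoset n → RankedPoset m →
                 (Fin n → Fin m → Bool) → Set
TwoPartSperner P Q F =
  ∀ x y u v → F x y ≡ true → F u v ≡ true → (x , y) ≢ (u , v) →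
    ¬ (RankedPoset._≼_ P x u × RankedPoset._≼_ Q y v × (x ≡ u ⊎ y ≡ v))

interCount : ∀ {n m} → (Fin n → Fin m → Bool) → (Fin n → Bool) → (Fin m → Bool) → ℕ
interCount {n} F C₁ C₂ = foldr (λ x acc → count (λ y → F x y ∧ C₁ x ∧ C₂ y) + acc) 0 (allFinL n)

module Submission where

open import Defs
open import Data.Nat using (ℕ; _≤_; _⊓_; _+_)
open import Data.Bool using (Bool)
open import Data.Fin using (Fin)

open import Data.Nat using (zero; suc; _<_; z≤n; s≤s; s≤s⁻¹; _⊔_)
open import Data.Nat.Properties using (≤-refl; ≤-reflexive; ≤-trans; <-trans; <-≤-trans; +-mono-≤; +-mono-≤-<; ≤∧≢⇒<; <⇒≢; n≮0; n<1+n; +-comm; m≤m⊔n; m≤n⊔m; ⊓-glb; +-distribʳ-⊓; +-commutativeSemigroup; _≟_; module ≤-Reasoning)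
open import Algebra.Properties.CommutativeSemigroup +-commutativeSemigroup using (interchange)
open import Data.Bool using (true; false; _∧_; if_then_else_)
open import Data.Bool.Properties using (∧-conicalˡ; ∧-conicalʳ)
open import Data.Fin using (zero; suc)
open import Data.Fin.Properties using (0≢1+n; suc-injective; any?) renaming (_≟_ to _≟ᶠ_)
open import Data.List using (foldr; tabulate)
open import Data.List.Properties using (map-tabulate)
open import Data.Product using (_,_; proj₁; proj₂)
open import Data.Sum using (inj₁; inj₂)
open import Function using (_∘_; id)
open import Relation.Binary.Definitions using (Decidable)
open import Relation.Binary.PropositionalEquality using (_≡_; refl; sym; trans; cong; cong₂)
open import Relation.Binary.Structures using (IsPartialOrder)
open import Relation.Nullary using (¬_; Dec; yes; no; contradiction)
open import Relation.Nullary.Decidable using (⌊_⌋; _×-dec_; ¬?)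

-- Put H = F ∩ (C₁ × C₂), a 0/1 matrix with rows indexed by
-- P and columns by Q.
--  * Every row of H has at most one entry: two entries (x,y), (x,y') have
--    y, y' comparable (C₂ is a chain), which the Sperner condition forbids
--    unless y = y'.  Symmetrically every column has at most one entry.
--  * Rank is strictly increasing along the strict order of a ranked poset
--    (induction on the size of the open interval), so it is injective on a
--    chain, and it takes values in {0,…,r(P)}; by pigeonhole a chain has at
--    most r(P)+1 elements.
--  * Hence |H| = Σ_x |row x| ≤ |C₁| ≤ r(P)+1, and after exchanging the order
--    of summation |H| = Σ_y |column y| ≤ |C₂| ≤ r(Q)+1.

∑ : ∀ {n} → (Fin n → ℕ) → ℕ
∑ {zero}  f = 0
∑ {suc n} f = f zero + ∑ (f ∘ suc)

∑-cong : ∀ {n} {f g : Fin n → ℕ} → (∀ x → f x ≡ g x) → ∑ f ≡ ∑ g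
∑-cong {zero}  f≗g = refl
∑-cong {suc n} f≗g = cong₂ _+_ (f≗g zero) (∑-cong (f≗g ∘ suc))

∑-mono : ∀ {n} {f g : Fin n → ℕ} → (∀ x → f x ≤ g x) → ∑ f ≤ ∑ g
∑-mono {zero}  f≤g = z≤n
∑-mono {suc n} f≤g = +-mono-≤ (f≤g zero) (∑-mono (f≤g ∘ suc))

∑-zero : ∀ n → ∑ {n} (λ _ → 0) ≡ 0
∑-zero zero    = refl
∑-zero (suc n) = ∑-zero n

∑-+ : ∀ {n} (f g : Fin n → ℕ) → ∑ (λ x → f x + g x) ≡ ∑ f + ∑ g
∑-+ {zero}  f g = refl
∑-+ {suc n} f g = trans (cong (f zero + g zero +_) (∑-+ (f ∘ suc) (g ∘ suc)))
                        (interchange (f zero) (g zero) (∑ (f ∘ suc)) (∑ (g ∘ suc)))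

∑-swap : ∀ {n m} (g : Fin n → Fin m → ℕ) →
         ∑ (λ x → ∑ (λ y → g x y)) ≡ ∑ (λ y → ∑ (λ x → g x y))
∑-swap {zero}  {m} g = sym (∑-zero m)
∑-swap {suc n}     g = trans (cong (∑ (g zero) +_) (∑-swap (g ∘ suc)))
                             (sym (∑-+ (g zero) (λ y → ∑ (λ x → g (suc x) y))))

foldr-tabulate : ∀ {n k} (g : Fin k → ℕ) (t : Fin n → Fin k) →
                 foldr (λ x acc → g x + acc) 0 (tabulate t) ≡ ∑ (g ∘ t)
foldr-tabulate {zero}  g t = refl
foldr-tabulate {suc n} g t = cong (g (t zero) +_) (foldr-tabulate g (t ∘ suc))

𝟙 : Bool → ℕ
𝟙 b = if b then 1 else 0

size : ∀ {n} → (Fin n → Bool) → ℕ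
size S = ∑ (𝟙 ∘ S)

interCount-as-sum : ∀ {n m} (F : Fin n → Fin m → Bool) (C₁ : Fin n → Bool) (C₂ : Fin m → Bool) →
                    interCount F C₁ C₂ ≡ ∑ (λ x → size (λ y → F x y ∧ C₁ x ∧ C₂ y))
interCount-as-sum F C₁ C₂ =
  trans (foldr-tabulate (λ x → count (λ y → F x y ∧ C₁ x ∧ C₂ y)) id)
        (∑-cong λ x → foldr-tabulate (λ y → 𝟙 (F x y ∧ C₁ x ∧ C₂ y)) id)

𝟙-mono : ∀ {b c} → (b ≡ true → c ≡ true) → 𝟙 b ≤ 𝟙 c
𝟙-mono {false}     _   = z≤n
𝟙-mono {true}  b⇒c rewrite b⇒c refl = ≤-refl

𝟙-false : ∀ {b} → ¬ (b ≡ true) → 𝟙 b ≡ 0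
𝟙-false {false} _   = refl
𝟙-false {true}  b≢t = contradiction refl b≢t

size-mono : ∀ {n} {S T : Fin n → Bool} → S ⊆ T → size S ≤ size T
size-mono S⊆T = ∑-mono (λ x → 𝟙-mono (S⊆T x))

size-empty : ∀ {n} (S : Fin n → Bool) → (∀ x → ¬ (S x ≡ true)) → size S ≡ 0
size-empty {n} S empty = trans (∑-cong (λ x → 𝟙-false (empty x))) (∑-zero n)

size-subsingleton : ∀ {n} (S : Fin n → Bool) →
                    (∀ x y → S x ≡ true → S y ≡ true → x ≡ y) → size S ≤ 1
size-subsingleton {zero}  S unique = z≤n
size-subsingleton {suc n} S unique with S zero in S0
... | true  = ≤-reflexive (cong suc (size-empty (S ∘ suc)
                (λ x Sx → 0≢1+n (unique zero (suc x) S0 Sx))))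
... | false = size-subsingleton (S ∘ suc)
                (λ x y Sx Sy → suc-injective (unique (suc x) (suc y) Sx Sy))

size-strict : ∀ {n} (S T : Fin n → Bool) → S ⊆ T →
              ∀ {c} → ¬ (S c ≡ true) → T c ≡ true → size S < size T
size-strict S T S⊆T {zero} c∉S c∈T with S zero
... | true  = contradiction refl c∉S
... | false rewrite c∈T = s≤s (size-mono (S⊆T ∘ suc))
size-strict S T S⊆T {suc c} c∉S c∈T =
  +-mono-≤-< (𝟙-mono (S⊆T zero)) (size-strict (S ∘ suc) (T ∘ suc) (S⊆T ∘ suc) c∉S c∈T)

size-split : ∀ {n p} {A : Fin n → Set p} (S : Fin n → Bool) (A? : ∀ x → Dec (A x)) →
             size S ≡ size (λ x → S x ∧ ⌊ A? x ⌋) + size (λ x → S x ∧ ⌊ ¬? (A? x) ⌋)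
size-split S A? = trans (∑-cong split-at)
                          (∑-+ (λ x → 𝟙 (S x ∧ ⌊ A? x ⌋)) (λ x → 𝟙 (S x ∧ ⌊ ¬? (A? x) ⌋)))
  where
    split-at : ∀ x → 𝟙 (S x) ≡ 𝟙 (S x ∧ ⌊ A? x ⌋) + 𝟙 (S x ∧ ⌊ ¬? (A? x) ⌋)
    split-at x with S x | A? x
    ... | false | _     = refl
    ... | true  | yes _ = refl
    ... | true  | no  _ = refl

infixr 6 _|∧|_
_|∧|_ : ∀ {a b} → a ≡ true → b ≡ true → a ∧ b ≡ true
refl |∧| refl = refl

⌊⌋-sound : ∀ {p} {A : Set p} (A? : Dec A) → ⌊ A? ⌋ ≡ true → A
⌊⌋-sound (yes a) _ = a

⌊⌋-complete : ∀ {p} {A : Set p} (A? : Dec A) → A → ⌊ A? ⌋ ≡ true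
⌊⌋-complete (yes _) _ = refl
⌊⌋-complete (no ¬a) a = contradiction a ¬a

-- Pigeonhole: if f is injective on S with values below k, then |S| ≤ k.
-- Induction on k: at most one element of S is sent to k - 1.
pigeonhole : ∀ {n} k (S : Fin n → Bool) (f : Fin n → ℕ) →
             (∀ x → S x ≡ true → f x < k) →
             (∀ x y → S x ≡ true → S y ≡ true → f x ≡ f y → x ≡ y) →
             size S ≤ k
pigeonhole zero S f bounded injective =
  ≤-reflexive (size-empty S (λ x Sx → n≮0 (bounded x Sx)))
pigeonhole {n} (suc k) S f bounded injective = begin
    size S                        ≡⟨ size-split S (λ x → f x ≟ k) ⟩
    size atTop + size belowTop    ≤⟨ +-mono-≤ atTop-subsingleton belowTop-bound ⟩
    1 + k                         ∎
  where
    open ≤-Reasoning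
    atTop belowTop : Fin n → Bool
    atTop    x = S x ∧ ⌊ f x ≟ k ⌋
    belowTop x = S x ∧ ⌊ ¬? (f x ≟ k) ⌋

    atTop-subsingleton : size atTop ≤ 1
    atTop-subsingleton = size-subsingleton atTop λ x y tx ty →
      injective x y (∧-conicalˡ _ _ tx) (∧-conicalˡ _ _ ty)
        (trans (⌊⌋-sound (f x ≟ k) (∧-conicalʳ _ _ tx))
               (sym (⌊⌋-sound (f y ≟ k) (∧-conicalʳ _ _ ty))))

    belowTop-bound : size belowTop ≤ k
    belowTop-bound = pigeonhole k belowTop f
      (λ x bx → ≤∧≢⇒< (s≤s⁻¹ (bounded x (∧-conicalˡ _ _ bx)))
                      (⌊⌋-sound (¬? (f x ≟ k)) (∧-conicalʳ _ _ bx)))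
      (λ x y bx by → injective x y (∧-conicalˡ _ _ bx) (∧-conicalˡ _ _ by))

≤-max-tabulate : ∀ {n} (h : Fin n → ℕ) x → h x ≤ foldr _⊔_ 0 (tabulate h)
≤-max-tabulate h zero    = m≤m⊔n (h zero) _
≤-max-tabulate h (suc x) = ≤-trans (≤-max-tabulate (h ∘ suc) x) (m≤n⊔m (h zero) _)

module RankedChains {n} (P : RankedPoset n) where
  open RankedPoset P hiding (r)
  open IsPartialOrder isPartialOrder using (antisym) renaming (trans to ≼-trans)

  _≺?_ : Decidable _≺_
  a ≺? b = (a ≼? b) ×-dec ¬? (a ≟ᶠ b)

  ≺-irrefl : ∀ {a} → ¬ (a ≺ a)
  ≺-irrefl (_ , a≢a) = a≢a refl

  ≺-trans : ∀ {a b c} → a ≺ b → b ≺ c → a ≺ c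
  ≺-trans (a≼b , a≢b) (b≼c , _) = ≼-trans a≼b b≼c , λ { refl → a≢b (antisym a≼b b≼c) }

  between : Fin n → Fin n → Fin n → Bool
  between x y z = ⌊ x ≺? z ⌋ ∧ ⌊ z ≺? y ⌋

  shrink-left : ∀ {x c y} → x ≺ c → c ≺ y → size (between x c) < size (between x y)
  shrink-left {x} {c} {y} x≺c c≺y =
    size-strict (between x c) (between x y)
      (λ z z∈ → ∧-conicalˡ _ _ z∈ |∧|
                ⌊⌋-complete (z ≺? y) (≺-trans (⌊⌋-sound (z ≺? c) (∧-conicalʳ _ _ z∈)) c≺y))
      (λ c∈ → ≺-irrefl (⌊⌋-sound (c ≺? c) (∧-conicalʳ _ _ c∈)))
      (⌊⌋-complete (x ≺? c) x≺c |∧| ⌊⌋-complete (c ≺? y) c≺y)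

  shrink-right : ∀ {x c y} → x ≺ c → c ≺ y → size (between c y) < size (between x y)
  shrink-right {x} {c} {y} x≺c c≺y =
    size-strict (between c y) (between x y)
      (λ z z∈ → ⌊⌋-complete (x ≺? z) (≺-trans x≺c (⌊⌋-sound (c ≺? z) (∧-conicalˡ _ _ z∈)))
                |∧| ∧-conicalʳ _ _ z∈)
      (λ c∈ → ≺-irrefl (⌊⌋-sound (c ≺? c) (∧-conicalˡ _ _ c∈)))
      (⌊⌋-complete (x ≺? c) x≺c |∧| ⌊⌋-complete (c ≺? y) c≺y)

  -- Induction on an upper bound k for the size of (x, y): either y covers x,
  -- or (x, y) splits at an interior point into two smaller intervals.
  rank-increasing-below : ∀ k {x y} → size (between x y) < k → x ≺ y → rank x < rank y
  rank-increasing-below (suc k) {x} {y} small x≺y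
    with any? (λ c → (x ≺? c) ×-dec (c ≺? y))
  ... | no nothing-between =
    ≤-reflexive (sym (rank-cover x y (x≺y , λ c x≺c≺y → nothing-between (c , x≺c≺y))))
  ... | yes (c , x≺c , c≺y) =
    <-trans (rank-increasing-below k (<-≤-trans (shrink-left x≺c c≺y) (s≤s⁻¹ small)) x≺c)
            (rank-increasing-below k (<-≤-trans (shrink-right x≺c c≺y) (s≤s⁻¹ small)) c≺y)

  rank-increasing : ∀ {x y} → x ≺ y → rank x < rank y
  rank-increasing = rank-increasing-below _ (n<1+n _)

  rank-injective-on-chain : ∀ {C} → Chain C →
    ∀ x y → C x ≡ true → C y ≡ true → rank x ≡ rank y → x ≡ y
  rank-injective-on-chain chain x y Cx Cy same-rank with x ≟ᶠ y
  ... | yes x≡y = x≡y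
  ... | no  x≢y with chain x y Cx Cy
  ... | inj₁ x≼y = contradiction same-rank (<⇒≢ (rank-increasing (x≼y , x≢y)))
  ... | inj₂ y≼x = contradiction (sym same-rank) (<⇒≢ (rank-increasing (y≼x , x≢y ∘ sym)))

  rank≤r : ∀ x → rank x ≤ r P
  rank≤r x = ≤-trans (≤-max-tabulate rank x)
                     (≤-reflexive (cong (foldr _⊔_ 0) (sym (map-tabulate id rank))))

  chain-size-bound : ∀ {C} → Chain C → size C ≤ r P + 1
  chain-size-bound {C} chain =
    pigeonhole (r P + 1) C rank
      (λ x _ → ≤-trans (s≤s (rank≤r x)) (≤-reflexive (+-comm 1 (r P))))
      (rank-injective-on-chain chain)

row-sum-bound : ∀ {n m} (H : Fin n → Fin m → Bool) (C : Fin n → Bool) →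
                (∀ x y → H x y ≡ true → C x ≡ true) →
                (∀ x y y′ → H x y ≡ true → H x y′ ≡ true → y ≡ y′) →
                ∑ (λ x → size (H x)) ≤ size C
row-sum-bound H C inC rows-unique = ∑-mono row-bound
  where
    row-bound : ∀ x → size (H x) ≤ 𝟙 (C x)
    row-bound x with C x in Cx
    ... | true  = size-subsingleton (H x) (rows-unique x)
    ... | false = ≤-reflexive (size-empty (H x)
                    (λ y Hxy → contradiction (trans (sym Cx) (inC x y Hxy)) λ ()))

module SpernerLines {n m} (P : RankedPoset n) (Q : RankedPoset m)
                    (F : Fin n → Fin m → Bool) (sperner : TwoPartSperner P Q F) where
  open RankedPoset using (_≼_; isPartialOrder; Chain)

  ≼P-refl : ∀ {x} → _≼_ P x x
  ≼P-refl = IsPartialOrder.refl (isPartialOrder P)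

  ≼Q-refl : ∀ {y} → _≼_ Q y y
  ≼Q-refl = IsPartialOrder.refl (isPartialOrder Q)

  row-ordered : ∀ {x y y′} → F x y ≡ true → F x y′ ≡ true → _≼_ Q y y′ → y ≡ y′
  row-ordered {x} {y} {y′} Fxy Fxy′ y≼y′ with y ≟ᶠ y′
  ... | yes y≡y′ = y≡y′
  ... | no  y≢y′ = contradiction (≼P-refl , y≼y′ , inj₁ refl)
                     (sperner x y x y′ Fxy Fxy′ (y≢y′ ∘ cong proj₂))

  column-ordered : ∀ {x x′ y} → F x y ≡ true → F x′ y ≡ true → _≼_ P x x′ → x ≡ x′
  column-ordered {x} {x′} {y} Fxy Fx′y x≼x′ with x ≟ᶠ x′
  ... | yes x≡x′ = x≡x′
  ... | no  x≢x′ = contradiction (x≼x′ , ≼Q-refl , inj₂ refl)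
                     (sperner x y x′ y Fxy Fx′y (x≢x′ ∘ cong proj₁))

  row-unique : ∀ {C} → Chain Q C → ∀ {x y y′} → F x y ≡ true → F x y′ ≡ true →
               C y ≡ true → C y′ ≡ true → y ≡ y′
  row-unique chain {y = y} {y′} Fxy Fxy′ Cy Cy′ with chain y y′ Cy Cy′
  ... | inj₁ y≼y′ = row-ordered Fxy Fxy′ y≼y′
  ... | inj₂ y′≼y = sym (row-ordered Fxy′ Fxy y′≼y)

  column-unique : ∀ {C} → Chain P C → ∀ {x x′ y} → F x y ≡ true → F x′ y ≡ true →
                  C x ≡ true → C x′ ≡ true → x ≡ x′
  column-unique chain {x} {x′} Fxy Fx′y Cx Cx′ with chain x x′ Cx Cx′
  ... | inj₁ x≼x′ = column-ordered Fxy Fx′y x≼x′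
  ... | inj₂ x′≼x = sym (column-ordered Fx′y Fxy x′≼x)

module Intersection {n m} (P : RankedPoset n) (Q : RankedPoset m)
                    (F : Fin n → Fin m → Bool) (sperner : TwoPartSperner P Q F)
                    (C₁ : Fin n → Bool) (C₂ : Fin m → Bool)
                    (chain₁ : RankedPoset.Chain P C₁) (chain₂ : RankedPoset.Chain Q C₂) where
  open ≤-Reasoning
  open SpernerLines P Q F sperner

  H : Fin n → Fin m → Bool
  H x y = F x y ∧ C₁ x ∧ C₂ y

  H⇒F : ∀ {x y} → H x y ≡ true → F x y ≡ true
  H⇒F {x} {y} = ∧-conicalˡ (F x y) _

  H⇒C₁ : ∀ {x y} → H x y ≡ true → C₁ x ≡ true
  H⇒C₁ {x} {y} h = ∧-conicalˡ (C₁ x) _ (∧-conicalʳ (F x y) _ h)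

  H⇒C₂ : ∀ {x y} → H x y ≡ true → C₂ y ≡ true
  H⇒C₂ {x} {y} h = ∧-conicalʳ (C₁ x) _ (∧-conicalʳ (F x y) _ h)

  rows-of-H : ∀ x y y′ → H x y ≡ true → H x y′ ≡ true → y ≡ y′
  rows-of-H _ _ _ h h′ = row-unique chain₂ (H⇒F h) (H⇒F h′) (H⇒C₂ h) (H⇒C₂ h′)

  columns-of-H : ∀ y x x′ → H x y ≡ true → H x′ y ≡ true → x ≡ x′
  columns-of-H _ _ _ h h′ = column-unique chain₁ (H⇒F h) (H⇒F h′) (H⇒C₁ h) (H⇒C₁ h′)

  bound-by-P : interCount F C₁ C₂ ≤ r P + 1
  bound-by-P = begin
    interCount F C₁ C₂     ≡⟨ interCount-as-sum F C₁ C₂ ⟩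
    ∑ (λ x → size (H x))   ≤⟨ row-sum-bound H C₁ (λ _ _ → H⇒C₁) rows-of-H ⟩
    size C₁                ≤⟨ RankedChains.chain-size-bound P chain₁ ⟩
    r P + 1                ∎

  bound-by-Q : interCount F C₁ C₂ ≤ r Q + 1
  bound-by-Q = begin
    interCount F C₁ C₂             ≡⟨ interCount-as-sum F C₁ C₂ ⟩
    ∑ (λ x → size (H x))           ≡⟨ ∑-swap (λ x y → 𝟙 (H x y)) ⟩
    ∑ (λ y → size (λ x → H x y))   ≤⟨ row-sum-bound (λ y x → H x y) C₂ (λ _ _ → H⇒C₂) columns-of-H ⟩
    size C₂                        ≤⟨ RankedChains.chain-size-bound Q chain₂ ⟩
    r Q + 1                        ∎

lemma3 : ∀ {n m} (P : RankedPoset n) (Q : RankedPoset m) →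
           Normal P → Normal Q →
           (F : Fin n → Fin m → Bool) → TwoPartSperner P Q F →
           (C₁ : Fin n → Bool) (C₂ : Fin m → Bool) →
           MaximalChain P C₁ → MaximalChain Q C₂ →
           interCount F C₁ C₂ ≤ (r P ⊓ r Q) + 1
lemma3 P Q _ _ F sperner C₁ C₂ (chain₁ , _) (chain₂ , _) = begin
    interCount F C₁ C₂     ≤⟨ ⊓-glb bound-by-P bound-by-Q ⟩
    (r P + 1) ⊓ (r Q + 1)  ≡⟨ +-distribʳ-⊓ 1 (r P) (r Q) ⟨
    r P ⊓ r Q + 1          ∎
  where
    open ≤-Reasoning
    open Intersection P Q F sperner C₁ C₂ chain₁ chain₂ using (bound-by-P; bound-by-Q)
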